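{- Define the bivariate series $$A(b,v)=1+(1+2C(b,v))(b-1),\quad U(b,v)=\frac{v}{(1+2C(b,v))^2},\quad B(a,u)=1-\frac{1-a}{Q(a,u)},\quad V(a,u)=uQ(a,u)^2.$$ Then $A(B(a,u),V(a,u))=a$ and $U(B(a,u),V(a,u))=u$; consequently, by inversion in $\mathbb{Q}[[a,u]]$, $B(A(b,v),U(b,v))=b$ and $V(A(b,v),U(b,v))=v$, and the identity $B(A(b,v),U(b,v))=b$ can be rewritten as $Q(A(b,v),U(b,v))=1+2C(b,v)$.
   Context: $Q(a,u)$ counts quarter plane square lattice loops (steps $(\pm1,0),(0,\pm1)$, from and to the origin, staying in $x,y\ge0$) by half-length ($u$) and number of $\mathsf{NW}$ plus $\mathsf{ES}$ factors ($a$). Equivalently it counts arch systems by number of arches and left-right pairs: an arch system on points $1,\dots,2n$ of a line consists of $n$ arches, each red (above the line) or blue (below), arches of the same colour never having interleaving endpoints; a left-right pair is a left endpoint of an arch immediately followed by the right endpoint of an arch of the other colour. Two arches of different colours cross if their endpoints interleave; components are connected components of the crossing graph; the system is connected if non-empty with one component, and standard if the leftmost arch of each component is red. $C(b,v)=\sum b^kv^n$ over standard connected arch systems with $n$ arches and $k$ left-right pairs. It is known that $Q(a,u)=1+2C\big(1-\frac{1-a}{Q(a,u)},uQ(a,u)^2\big)$. -}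

module Defs where

open import Data.Bool using (Bool; true; false; _∧_; _∨_; not; if_then_else_)
open import Data.Nat as ℕ using (ℕ; zero; suc; _≡ᵇ_; _<ᵇ_)
open import Data.List as List using (List; []; _∷_; length; filterᵇ; concatMap; map; upTo)
open import Data.Bool.ListAction using (all; any)
open import Relation.Binary.PropositionalEquality using (_≡_)
open import Data.Integer using (+_)
open import Data.Rational using (ℚ; 0ℚ; 1ℚ; _+_; _*_; _-_; _/_)

countᵇ : {A : Set} → (A → Bool) → List A → ℕ
countᵇ p xs = length (filterᵇ p xs)

lists : {A : Set} → ℕ → List A → List (List A)
lists zero    xs = [] ∷ []
lists (suc m) xs = concatMap (λ x → map (x ∷_) (lists m xs)) xs

data Step : Set where
  N E S W : Step

allSteps : List Step
allSteps = N ∷ E ∷ S ∷ W ∷ []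

qpLoopFrom : ℕ → ℕ → List Step → Bool
qpLoopFrom zero    zero    []      = true
qpLoopFrom _       _       []      = false
qpLoopFrom x       y       (N ∷ w) = qpLoopFrom x (suc y) w
qpLoopFrom x       y       (E ∷ w) = qpLoopFrom (suc x) y w
qpLoopFrom x       zero    (S ∷ w) = false
qpLoopFrom x       (suc y) (S ∷ w) = qpLoopFrom x y w
qpLoopFrom zero    y       (W ∷ w) = false
qpLoopFrom (suc x) y       (W ∷ w) = qpLoopFrom x y w

nwes : List Step → ℕ
nwes (N ∷ W ∷ w) = suc (nwes (W ∷ w))
nwes (E ∷ S ∷ w) = suc (nwes (S ∷ w))
nwes (_ ∷ w)     = nwes w
nwes []          = 0

qCoeff : ℕ → ℕ → ℕ
qCoeff k n = countᵇ (λ w → qpLoopFrom 0 0 w ∧ (nwes w ≡ᵇ k)) (lists (2 ℕ.* n) allSteps)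

-- Arch systems on the points 0,1,…,2n-1 (the paper's 1,…,2n shifted by one)

data Colour : Set where
  red blue : Colour

_≡ᶜ_ : Colour → Colour → Bool
red  ≡ᶜ red  = true
blue ≡ᶜ blue = true
_    ≡ᶜ _    = false

record Arch : Set where
  constructor arch
  field
    col   : Colour
    left  : ℕ
    right : ℕ
open Arch public

_≡ᵃ_ : Arch → Arch → Bool
a ≡ᵃ b = (col a ≡ᶜ col b) ∧ (left a ≡ᵇ left b) ∧ (right a ≡ᵇ right b)

interleaveᵇ : Arch → Arch → Bool
interleaveᵇ a b = (left a <ᵇ left b) ∧ (left b <ᵇ right a) ∧ (right a <ᵇ right b)

interleavingᵇ : Arch → Arch → Bool
interleavingᵇ a b = interleaveᵇ a b ∨ interleaveᵇ b a

crossᵇ : Arch → Arch → Bool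
crossᵇ a b = not (col a ≡ᶜ col b) ∧ interleavingᵇ a b

candidateArches : ℕ → List Arch
candidateArches n =
  concatMap (λ c → concatMap (λ l → map (arch c l) (upTo (2 ℕ.* n))) (upTo (2 ℕ.* n)))
            (red ∷ blue ∷ [])

sortedByLeft : List Arch → Bool
sortedByLeft (a ∷ b ∷ as) = (left a <ᵇ left b) ∧ sortedByLeft (b ∷ as)
sortedByLeft _            = true

-- a list of arches (listed by increasing left endpoint, so each arch system is
-- represented exactly once) is an arch system on 0,…,2n-1 with n arches
isArchSystem : ℕ → List Arch → Bool
isArchSystem n as =
  (length as ≡ᵇ n)
  ∧ all (λ a → (left a <ᵇ right a) ∧ (right a <ᵇ 2 ℕ.* n)) as
  ∧ sortedByLeft as
  ∧ all (λ p → countᵇ (λ a → (left a ≡ᵇ p) ∨ (right a ≡ᵇ p)) as ≡ᵇ 1) (upTo (2 ℕ.* n))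
  ∧ all (λ a → all (λ b → not ((col a ≡ᶜ col b) ∧ interleavingᵇ a b)) as) as

archSystems : ℕ → List (List Arch)
archSystems n = List.filterᵇ (isArchSystem n) (lists n (candidateArches n))

leftRightPairs : ℕ → List Arch → ℕ
leftRightPairs n as =
  countᵇ (λ p → any (λ a → any (λ b → (left a ≡ᵇ p) ∧ (right b ≡ᵇ suc p)
                                       ∧ not (col a ≡ᶜ col b)) as) as)
         (upTo (2 ℕ.* n))

-- connectivity of the crossing graph: grow the set of arches reachable from
-- the first arch, one crossing-step at a time (length as iterations suffice)
reachStep : List Arch → List Arch → List Arch
reachStep as R = filterᵇ (λ b → any (λ a → (a ≡ᵃ b) ∨ crossᵇ a b) R) as

reachIter : ℕ → List Arch → List Arch → List Arch
reachIter zero    as R = R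
reachIter (suc t) as R = reachIter t as (reachStep as R)

connectedᵇ : List Arch → Bool
connectedᵇ []         = false
connectedᵇ (a ∷ as)   =
  all (λ b → any (λ c → c ≡ᵃ b) (reachIter (length (a ∷ as)) (a ∷ as) (a ∷ [])))
      (a ∷ as)

-- for a connected system (single component) standard means the leftmost arch
-- is red; the list is sorted by left endpoint so this is the head
leftmostRedᵇ : List Arch → Bool
leftmostRedᵇ []       = false
leftmostRedᵇ (a ∷ as) = col a ≡ᶜ red

cCoeff : ℕ → ℕ → ℕ
cCoeff k n = countᵇ (λ as → connectedᵇ as ∧ leftmostRedᵇ as ∧ (leftRightPairs n as ≡ᵇ k))
                    (archSystems n)

-- Formal power series in two variables over ℚ:  f i j = [x^i y^j] f

Ser : Set
Ser = ℕ → ℕ → ℚ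

fromℕ : ℕ → ℚ
fromℕ m = + m / 1

sumTo : ℕ → (ℕ → ℚ) → ℚ
sumTo zero    f = f 0
sumTo (suc n) f = sumTo n f + f (suc n)

const : ℚ → Ser
const c i j = if (i ≡ᵇ 0) ∧ (j ≡ᵇ 0) then c else 0ℚ

Xs : Ser
Xs i j = if (i ≡ᵇ 1) ∧ (j ≡ᵇ 0) then 1ℚ else 0ℚ

Ys : Ser
Ys i j = (if (i ≡ᵇ 0) ∧ (j ≡ᵇ 1) then 1ℚ else 0ℚ)

_⊕_ : Ser → Ser → Ser
(f ⊕ g) i j = f i j + g i j

_⊖_ : Ser → Ser → Ser
(f ⊖ g) i j = f i j - g i j

_⊛_ : Ser → Ser → Ser
(f ⊛ g) i j = sumTo i (λ a → sumTo j (λ b → f a b * g (i ℕ.∸ a) (j ℕ.∸ b)))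

_^ˢ_ : Ser → ℕ → Ser
f ^ˢ zero  = const 1ℚ
f ^ˢ suc m = f ⊛ (f ^ˢ m)

-- multiplicative inverse of a series with constant term 1:
-- 1/f = Σ_m (1 - f)^m, and (1-f)^m has total degree ≥ m
inv : Ser → Ser
inv f i j = sumTo (i ℕ.+ j) (λ m → ((const 1ℚ ⊖ f) ^ˢ m) i j)

-- substitution F(G,H) for G,H with G(x,0) = x and H(x,0) = 0 (the only case
-- used): [x^i y^j] G^k H^n vanishes unless n ≤ j and k ≤ i + j
subst : Ser → Ser → Ser → Ser
subst F G H i j =
  sumTo j (λ n → sumTo (i ℕ.+ j) (λ k → F k n * ((G ^ˢ k) ⊛ (H ^ˢ n)) i j))

Q : Ser
Q k n = fromℕ (qCoeff k n)

C : Ser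
C k n = fromℕ (cCoeff k n)

one+2C : Ser
one+2C = const 1ℚ ⊕ (const (fromℕ 2) ⊛ C)

A : Ser
A = const 1ℚ ⊕ (one+2C ⊛ (Xs ⊖ const 1ℚ))

U : Ser
U = Ys ⊛ inv (one+2C ⊛ one+2C)

B : Ser
B = const 1ℚ ⊖ ((const 1ℚ ⊖ Xs) ⊛ inv Q)

V : Ser
V = Ys ⊛ (Q ⊛ Q)

_≐_ : Ser → Ser → Set
f ≐ g = ∀ i j → f i j ≡ g i j

-- Substitution F ↦ F(G,H) is a ring homomorphism of ℚ[[x,y]] whenever G has no
-- constant term and y divides H (each coefficient is then a finite sum), and
-- substitutions compose. Granting Q = 1 + 2C(B,V), a direct computation gives
-- A(B,V) = x and U(B,V) = y, so substituting (A,U) and then (B,V) is the identity.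
-- As B ≡ x and V ≡ y modulo y and y² respectively, substituting (B,V) is triangular
-- in y with unit diagonal, hence injective; applied to B(A,U), V(A,U) and Q(A,U)
-- this yields the remaining three identities.
module Submission where

open import Defs
open import Algebra.Bundles using (CommutativeMonoid)
open import Data.Bool using (true; false; if_then_else_; _∧_)
open import Data.Empty using (⊥-elim)
open import Data.Nat as ℕ using (ℕ; zero; suc; _≤_; _<_; z≤n; s≤s; _∸_)
import Data.Nat.Properties as ℕₚ
import Algebra.Properties.CommutativeSemigroup as CommutativeSemigroupProperties
open import Data.Product using (_×_; _,_)
open import Data.Rational using (ℚ; 0ℚ; 1ℚ; _+_; _*_; _-_; -_)
open import Data.Rational.Properties
  using ( +-0-commutativeMonoid; *-1-commutativeMonoid; +-*-ring; +-inverseʳ; +-assoc; +-comm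
        ; +-identityˡ; +-identityʳ; *-assoc; *-comm; *-identityˡ; *-identityʳ; *-zeroˡ; *-zeroʳ
        ; *-distribˡ-+; *-distribʳ-+; neg-distrib-+ )
open import Data.Rational.Solver using (module +-*-Solver)
open import Data.Sum using (_⊎_; inj₁; inj₂)
open import Level using (0ℓ)
open import Relation.Binary.Bundles using (Setoid)
open import Relation.Binary.Definitions using (tri<; tri≈; tri>)
open import Relation.Binary.PropositionalEquality
  using (_≡_; _≢_; refl; sym; trans; cong; cong₂; module ≡-Reasoning) renaming (subst to transport)
import Relation.Binary.Reasoning.Setoid
open import Relation.Nullary using (yes; no)

open import Algebra.Properties.Ring +-*-ring using ([y-z]x≈yx-zx)
open +-*-Solver using (solve; _:+_; _:-_; _:=_)
open CommutativeSemigroupProperties (CommutativeMonoid.commutativeSemigroup +-0-commutativeMonoid)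
  using () renaming (interchange to +-interchange)
open CommutativeSemigroupProperties (CommutativeMonoid.commutativeSemigroup *-1-commutativeMonoid)
  using () renaming (interchange to *-interchange)
open CommutativeSemigroupProperties ℕₚ.+-commutativeSemigroup using () renaming (interchange to ℕ-+-interchange)

y≡0⇒x*y≡0 : ∀ x {y} → y ≡ 0ℚ → x * y ≡ 0ℚ
y≡0⇒x*y≡0 x refl = *-zeroʳ x

x≡0⇒x*y≡0 : ∀ {x} y → x ≡ 0ℚ → x * y ≡ 0ℚ
x≡0⇒x*y≡0 y refl = *-zeroˡ y

sumTo-cong : ∀ n {f g : ℕ → ℚ} → (∀ k → f k ≡ g k) → sumTo n f ≡ sumTo n g
sumTo-cong zero    f≡g = f≡g 0
sumTo-cong (suc n) f≡g = cong₂ _+_ (sumTo-cong n f≡g) (f≡g (suc n))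

sumTo-cong≤ : ∀ n {f g : ℕ → ℚ} → (∀ k → k ≤ n → f k ≡ g k) → sumTo n f ≡ sumTo n g
sumTo-cong≤ zero    f≡g = f≡g 0 z≤n
sumTo-cong≤ (suc n) f≡g =
  cong₂ _+_ (sumTo-cong≤ n (λ k k≤n → f≡g k (ℕₚ.m≤n⇒m≤1+n k≤n))) (f≡g (suc n) ℕₚ.≤-refl)

sumTo-zero : ∀ n (f : ℕ → ℚ) → (∀ k → k ≤ n → f k ≡ 0ℚ) → sumTo n f ≡ 0ℚ
sumTo-zero zero    f f≡0 = f≡0 0 z≤n
sumTo-zero (suc n) f f≡0 =
  cong₂ _+_ (sumTo-zero n f (λ k k≤n → f≡0 k (ℕₚ.m≤n⇒m≤1+n k≤n))) (f≡0 (suc n) ℕₚ.≤-refl)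

sumTo-+ : ∀ n (f g : ℕ → ℚ) → sumTo n (λ k → f k + g k) ≡ sumTo n f + sumTo n g
sumTo-+ zero    f g = refl
sumTo-+ (suc n) f g =
  trans (cong (_+ (f (suc n) + g (suc n))) (sumTo-+ n f g))
        (+-interchange (sumTo n f) (sumTo n g) (f (suc n)) (g (suc n)))

sumTo-- : ∀ n (f g : ℕ → ℚ) → sumTo n (λ k → f k - g k) ≡ sumTo n f - sumTo n g
sumTo-- n f g = trans (sumTo-+ n f (λ k → - g k)) (cong (sumTo n f +_) (sym (sumTo-neg n)))
  where
  sumTo-neg : ∀ n → - sumTo n g ≡ sumTo n (λ k → - g k)
  sumTo-neg zero    = refl
  sumTo-neg (suc n) = trans (neg-distrib-+ (sumTo n g) (g (suc n))) (cong (_+ (- g (suc n))) (sumTo-neg n))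

sumTo-*ˡ : ∀ n c (f : ℕ → ℚ) → c * sumTo n f ≡ sumTo n (λ k → c * f k)
sumTo-*ˡ zero    c f = refl
sumTo-*ˡ (suc n) c f = trans (*-distribˡ-+ c (sumTo n f) (f (suc n))) (cong (_+ (c * f (suc n))) (sumTo-*ˡ n c f))

sumTo-*ʳ : ∀ n c (f : ℕ → ℚ) → sumTo n f * c ≡ sumTo n (λ k → f k * c)
sumTo-*ʳ n c f = trans (*-comm _ c) (trans (sumTo-*ˡ n c f) (sumTo-cong n (λ k → *-comm c (f k))))

sumTo-swap : ∀ m n (f : ℕ → ℕ → ℚ) →
  sumTo m (λ a → sumTo n (f a)) ≡ sumTo n (λ b → sumTo m (λ a → f a b))
sumTo-swap zero    n f = refl
sumTo-swap (suc m) n f =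
  trans (cong (_+ sumTo n (f (suc m))) (sumTo-swap m n f))
        (sym (sumTo-+ n (λ b → sumTo m (λ a → f a b)) (f (suc m))))

sumTo-extend : ∀ {n} L (f : ℕ → ℚ) → n ≤ L → (∀ k → n < k → f k ≡ 0ℚ) → sumTo n f ≡ sumTo L f
sumTo-extend zero    f z≤n     _   = refl
sumTo-extend (suc L) f n≤1+L f≡0 with ℕₚ.m≤n⇒m<n∨m≡n n≤1+L
... | inj₂ refl      = refl
... | inj₁ (s≤s n≤L) =
  trans (sumTo-extend L f n≤L f≡0)
        (trans (sym (+-identityʳ (sumTo L f))) (cong (sumTo L f +_) (sym (f≡0 (suc L) (s≤s n≤L)))))

sumTo-single : ∀ n m (f : ℕ → ℚ) → m ≤ n → (∀ k → k ≤ n → k ≢ m → f k ≡ 0ℚ) → sumTo n f ≡ f m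
sumTo-single zero .zero f z≤n _ = refl
sumTo-single (suc n) m f m≤1+n f≡0 with m ℕₚ.≟ suc n
... | yes refl =
  trans (cong (_+ f (suc n)) (sumTo-zero n f (λ k k≤n →
          f≡0 k (ℕₚ.m≤n⇒m≤1+n k≤n) (λ { refl → ℕₚ.<-irrefl refl (s≤s k≤n) }))))
        (+-identityˡ _)
... | no m≢1+n =
  trans (cong₂ _+_ (sumTo-single n m f (ℕₚ.≤-pred (ℕₚ.≤∧≢⇒< m≤1+n m≢1+n))
                                 (λ k k≤n → f≡0 k (ℕₚ.m≤n⇒m≤1+n k≤n)))
                   (f≡0 (suc n) ℕₚ.≤-refl (λ e → m≢1+n (sym e))))
        (+-identityʳ _)

sumTo-telescope : ∀ n (g : ℕ → ℚ) → sumTo n (λ m → g m - g (suc m)) ≡ g 0 - g (suc n)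
sumTo-telescope zero    g = refl
sumTo-telescope (suc n) g =
  trans (cong (_+ (g (suc n) - g (suc (suc n)))) (sumTo-telescope n g))
        (solve 3 (λ a b c → (a :- b) :+ (b :- c) := a :- c) refl (g 0) (g (suc n)) (g (suc (suc n))))

sumTo-reverse : ∀ n (f : ℕ → ℚ) → sumTo n f ≡ sumTo n (λ a → f (n ∸ a))
sumTo-reverse zero    f = refl
sumTo-reverse (suc n) f = begin
    sumTo (suc n) f
  ≡⟨ sumTo-unshift n f ⟩
    f 0 + sumTo n (λ a → f (suc a))
  ≡⟨ cong (f 0 +_) (sumTo-reverse n (λ a → f (suc a))) ⟩
    f 0 + sumTo n (λ a → f (suc (n ∸ a)))
  ≡⟨ +-comm (f 0) _ ⟩
    sumTo n (λ a → f (suc (n ∸ a))) + f 0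
  ≡⟨ cong₂ _+_ (sumTo-cong≤ n (λ a a≤n → cong f (sym (ℕₚ.+-∸-assoc 1 a≤n))))
               (cong f (sym (ℕₚ.n∸n≡0 n))) ⟩
    sumTo (suc n) (λ a → f (suc n ∸ a))
  ∎
  where
  open ≡-Reasoning
  sumTo-unshift : ∀ n (f : ℕ → ℚ) → sumTo (suc n) f ≡ f 0 + sumTo n (λ a → f (suc a))
  sumTo-unshift zero    f = refl
  sumTo-unshift (suc n) f = trans (cong (_+ f (suc (suc n))) (sumTo-unshift n f)) (+-assoc (f 0) _ _)

sumTo-triangle : ∀ L (F : ℕ → ℕ → ℚ) →
  sumTo L (λ a → sumTo a (λ c → F c a)) ≡ sumTo L (λ c → sumTo (L ∸ c) (λ e → F c (c ℕ.+ e)))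
sumTo-triangle zero    F = refl
sumTo-triangle (suc L) F = begin
    sumTo L (λ a → sumTo a (λ c → F c a)) + sumTo (suc L) (λ c → F c (suc L))
  ≡⟨ cong (_+ sumTo (suc L) (λ c → F c (suc L))) (sumTo-triangle L F) ⟩
    Rows L + (sumTo L (λ c → F c (suc L)) + F (suc L) (suc L))
  ≡⟨ sym (+-assoc (Rows L) (sumTo L (λ c → F c (suc L))) (F (suc L) (suc L))) ⟩
    (Rows L + sumTo L (λ c → F c (suc L))) + F (suc L) (suc L)
  ≡⟨ cong₂ _+_ (sym (sumTo-+ L _ _)) (cong (F (suc L)) (sym (ℕₚ.+-identityʳ (suc L)))) ⟩
    sumTo L (λ c → sumTo (L ∸ c) (λ e → F c (c ℕ.+ e)) + F c (suc L)) + F (suc L) (suc L ℕ.+ 0)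
  ≡⟨ cong₂ _+_ (sumTo-cong≤ L extend-row)
               (cong (λ z → sumTo z (λ e → F (suc L) (suc L ℕ.+ e))) (sym (ℕₚ.n∸n≡0 L))) ⟩
    sumTo L (λ c → sumTo (suc L ∸ c) (λ e → F c (c ℕ.+ e))) + sumTo (L ∸ L) (λ e → F (suc L) (suc L ℕ.+ e))
  ∎
  where
  open ≡-Reasoning
  Rows : ℕ → ℚ
  Rows L = sumTo L (λ c → sumTo (L ∸ c) (λ e → F c (c ℕ.+ e)))
  extend-row : ∀ c → c ≤ L →
    sumTo (L ∸ c) (λ e → F c (c ℕ.+ e)) + F c (suc L) ≡ sumTo (suc L ∸ c) (λ e → F c (c ℕ.+ e))
  extend-row c c≤L rewrite ℕₚ.+-∸-assoc 1 c≤L =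
    cong (sumTo (L ∸ c) (λ e → F c (c ℕ.+ e)) +_)
         (cong (F c) (sym (trans (ℕₚ.+-suc c (L ∸ c)) (cong suc (ℕₚ.m+[n∸m]≡n c≤L)))))

-- Box sums; (f ⊛ g) i j is definitionally one.

sumBox : ℕ → ℕ → (ℕ → ℕ → ℚ) → ℚ
sumBox I J f = sumTo I (λ a → sumTo J (f a))

sumBox-cong : ∀ I J {f g : ℕ → ℕ → ℚ} → (∀ a b → f a b ≡ g a b) → sumBox I J f ≡ sumBox I J g
sumBox-cong I J f≡g = sumTo-cong I (λ a → sumTo-cong J (f≡g a))

sumBox-zero : ∀ I J (f : ℕ → ℕ → ℚ) → (∀ a b → a ≤ I → b ≤ J → f a b ≡ 0ℚ) → sumBox I J f ≡ 0ℚ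
sumBox-zero I J f f≡0 = sumTo-zero I _ (λ a a≤I → sumTo-zero J _ (λ b b≤J → f≡0 a b a≤I b≤J))

sumBox-antidiagonal : ∀ K (X : ℕ → ℕ → ℚ) → (∀ a c → K < a ℕ.+ c → X a c ≡ 0ℚ) →
  sumTo K (λ k → sumTo k (λ a → X a (k ∸ a))) ≡ sumBox K K X
sumBox-antidiagonal K X X≡0 = trans (sumTo-triangle K (λ a k → X a (k ∸ a)))
  (sumTo-cong≤ K (λ a a≤K → trans (sumTo-cong (K ∸ a) (λ e → cong (X a) (ℕₚ.m+n∸m≡n a e)))
     (sumTo-extend K (X a) (ℕₚ.m∸n≤m K a)
        (λ e K∸a<e → X≡0 a e (transport (_< a ℕ.+ e) (ℕₚ.m+[n∸m]≡n a≤K) (ℕₚ.+-monoʳ-< a K∸a<e))))))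

sumTo-sumBox-swap : ∀ L I J (f : ℕ → ℕ → ℕ → ℚ) →
  sumTo L (λ q → sumBox I J (f q)) ≡ sumBox I J (λ a b → sumTo L (λ q → f q a b))
sumTo-sumBox-swap L I J f =
  trans (sumTo-swap L I _) (sumTo-cong I (λ a → sumTo-swap L J (λ q → f q a)))

sumBox-swap : ∀ I J I′ J′ (f : ℕ → ℕ → ℕ → ℕ → ℚ) →
  sumBox I J (λ a b → sumBox I′ J′ (f a b)) ≡ sumBox I′ J′ (λ c d → sumBox I J (λ a b → f a b c d))
sumBox-swap I J I′ J′ f =
  trans (sumTo-cong I (λ a → sumTo-sumBox-swap J I′ J′ (f a)))
        (sumTo-sumBox-swap I I′ J′ (λ a c d → sumTo J (λ b → f a b c d)))

sumBox-* : ∀ I J I′ J′ (f g : ℕ → ℕ → ℚ) →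
  sumBox I J f * sumBox I′ J′ g ≡ sumBox I J (λ a b → sumBox I′ J′ (λ c d → f a b * g c d))
sumBox-* I J I′ J′ f g =
  trans (sumTo-*ʳ I _ _) (sumTo-cong I (λ a → trans (sumTo-*ʳ J _ _) (sumTo-cong J (λ b →
    trans (sumTo-*ˡ I′ (f a b) _) (sumTo-cong I′ (λ c → sumTo-*ˡ J′ (f a b) (g c)))))))

≐-refl : ∀ {f} → f ≐ f
≐-refl i j = refl

≐-sym : ∀ {f g} → f ≐ g → g ≐ f
≐-sym f≐g i j = sym (f≐g i j)

≐-trans : ∀ {f g h} → f ≐ g → g ≐ h → f ≐ h
≐-trans f≐g g≐h i j = trans (f≐g i j) (g≐h i j)

≐-setoid : Setoid 0ℓ 0ℓ
≐-setoid = record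
  { Carrier       = Ser
  ; _≈_           = _≐_
  ; isEquivalence = record { refl = ≐-refl ; sym = ≐-sym ; trans = ≐-trans }
  }

module ≐-Reasoning = Relation.Binary.Reasoning.Setoid ≐-setoid

⊕-cong : ∀ {f f′ g g′} → f ≐ f′ → g ≐ g′ → (f ⊕ g) ≐ (f′ ⊕ g′)
⊕-cong f≐f′ g≐g′ i j = cong₂ _+_ (f≐f′ i j) (g≐g′ i j)

⊖-cong : ∀ {f f′ g g′} → f ≐ f′ → g ≐ g′ → (f ⊖ g) ≐ (f′ ⊖ g′)
⊖-cong f≐f′ g≐g′ i j = cong₂ _-_ (f≐f′ i j) (g≐g′ i j)

⊛-cong : ∀ {f f′ g g′} → f ≐ f′ → g ≐ g′ → (f ⊛ g) ≐ (f′ ⊛ g′)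
⊛-cong f≐f′ g≐g′ i j = sumBox-cong i j (λ a b → cong₂ _*_ (f≐f′ a b) (g≐g′ (i ∸ a) (j ∸ b)))

^ˢ-cong : ∀ {f f′} → f ≐ f′ → ∀ m → (f ^ˢ m) ≐ (f′ ^ˢ m)
^ˢ-cong f≐f′ zero    = ≐-refl
^ˢ-cong f≐f′ (suc m) = ⊛-cong f≐f′ (^ˢ-cong f≐f′ m)

⊛-comm : ∀ f g → (f ⊛ g) ≐ (g ⊛ f)
⊛-comm f g i j =
  trans (sumTo-reverse i _)
  (sumTo-cong≤ i (λ a a≤i → trans (sumTo-reverse j _)
     (sumTo-cong≤ j (λ b b≤j → trans (*-comm (f (i ∸ a) (j ∸ b)) (g (i ∸ (i ∸ a)) (j ∸ (j ∸ b))))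
        (cong₂ (λ x y → g x y * f (i ∸ a) (j ∸ b)) (ℕₚ.m∸[m∸n]≡n a≤i) (ℕₚ.m∸[m∸n]≡n b≤j))))))

const-⊛ : ∀ c f i j → (const c ⊛ f) i j ≡ c * f i j
const-⊛ c f i j =
  trans (sumTo-single i 0 _ z≤n (λ a _ a≢0 → sumTo-zero j _ (λ b _ →
           x≡0⇒x*y≡0 (f (i ∸ a) (j ∸ b)) (const-off c a b (inj₁ a≢0)))))
        (sumTo-single j 0 _ z≤n (λ b _ b≢0 → x≡0⇒x*y≡0 (f i (j ∸ b)) (const-off c 0 b (inj₂ b≢0))))
  where
  const-off : ∀ c a b → a ≢ 0 ⊎ b ≢ 0 → const c a b ≡ 0ℚ
  const-off c zero    zero    (inj₁ a≢0) = ⊥-elim (a≢0 refl)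
  const-off c zero    zero    (inj₂ b≢0) = ⊥-elim (b≢0 refl)
  const-off c zero    (suc b) _          = refl
  const-off c (suc a) b       _          = refl

⊛-identityˡ : ∀ f → (const 1ℚ ⊛ f) ≐ f
⊛-identityˡ f i j = trans (const-⊛ 1ℚ f i j) (*-identityˡ (f i j))

⊛-identityʳ : ∀ f → (f ⊛ const 1ℚ) ≐ f
⊛-identityʳ f = ≐-trans (⊛-comm f (const 1ℚ)) (⊛-identityˡ f)

⊛-distribʳ-⊖ : ∀ f g h → ((g ⊖ h) ⊛ f) ≐ ((g ⊛ f) ⊖ (h ⊛ f))
⊛-distribʳ-⊖ f g h i j =
  trans (sumTo-cong i (λ a → trans (sumTo-cong j (λ b → [y-z]x≈yx-zx (f (i ∸ a) (j ∸ b)) (g a b) (h a b)))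
                                   (sumTo-- j _ _)))
        (sumTo-- i _ _)

⊛-distribˡ-⊖ : ∀ f g h → (f ⊛ (g ⊖ h)) ≐ ((f ⊛ g) ⊖ (f ⊛ h))
⊛-distribˡ-⊖ f g h =
  ≐-trans (⊛-comm f (g ⊖ h)) (≐-trans (⊛-distribʳ-⊖ f g h) (⊖-cong (⊛-comm g f) (⊛-comm h f)))

sumBox-⊛ : ∀ I J (F F′ ω : Ser) → (∀ k n → I < k → ω k n ≡ 0ℚ) → (∀ k n → J < n → ω k n ≡ 0ℚ) →
  sumBox I J (λ k n → (F ⊛ F′) k n * ω k n)
  ≡ sumBox I J (λ a b → sumBox I J (λ c d → F a b * F′ c d * ω (a ℕ.+ c) (b ℕ.+ d)))
sumBox-⊛ I J F F′ ω ω≡0ᴵ ω≡0ᴶ = begin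
    sumBox I J (λ k n → (F ⊛ F′) k n * ω k n)
  ≡⟨ sumBox-cong I J (λ k n → sumTo-*ʳ k (ω k n) _) ⟩
    sumTo I (λ k → sumTo J (λ n → sumTo k (λ a → T a k n)))
  ≡⟨ sumTo-cong I (λ k → sumTo-swap J k _) ⟩
    sumTo I (λ k → sumTo k (λ a → sumTo J (λ n → T a k n)))
  ≡⟨ sumTo-cong I (λ k → sumTo-cong≤ k (λ a a≤k → sumTo-cong J (λ n →
        cong (λ z → sumTo n (λ b → F a b * F′ (k ∸ a) (n ∸ b)) * ω z n) (sym (ℕₚ.m+[n∸m]≡n a≤k))))) ⟩
    sumTo I (λ k → sumTo k (λ a → X a (k ∸ a)))
  ≡⟨ sumBox-antidiagonal I X (λ a c I<a+c → sumTo-zero J _ (λ n _ →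
        y≡0⇒x*y≡0 (sumTo n (λ b → F a b * F′ c (n ∸ b))) (ω≡0ᴵ (a ℕ.+ c) n I<a+c))) ⟩
    sumBox I I X
  ≡⟨ sumBox-cong I I expand-X ⟩
    sumBox I I (λ a c → sumBox J J (λ b d → F a b * F′ c d * ω (a ℕ.+ c) (b ℕ.+ d)))
  ≡⟨ sumTo-cong I (λ a → sumTo-swap I J _) ⟩
    sumBox I J (λ a b → sumBox I J (λ c d → F a b * F′ c d * ω (a ℕ.+ c) (b ℕ.+ d)))
  ∎
  where
  open ≡-Reasoning
  T : ℕ → ℕ → ℕ → ℚ
  T a k n = sumTo n (λ b → F a b * F′ (k ∸ a) (n ∸ b)) * ω k n
  X : ℕ → ℕ → ℚ
  X a c = sumTo J (λ n → sumTo n (λ b → F a b * F′ c (n ∸ b)) * ω (a ℕ.+ c) n)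
  expand-X : ∀ a c → X a c ≡ sumBox J J (λ b d → F a b * F′ c d * ω (a ℕ.+ c) (b ℕ.+ d))
  expand-X a c = begin
      X a c
    ≡⟨ sumTo-cong J (λ n → sumTo-*ʳ n (ω (a ℕ.+ c) n) _) ⟩
      sumTo J (λ n → sumTo n (λ b → F a b * F′ c (n ∸ b) * ω (a ℕ.+ c) n))
    ≡⟨ sumTo-cong J (λ n → sumTo-cong≤ n (λ b b≤n →
          cong (λ z → F a b * F′ c (n ∸ b) * ω (a ℕ.+ c) z) (sym (ℕₚ.m+[n∸m]≡n b≤n)))) ⟩
      sumTo J (λ n → sumTo n (λ b → F a b * F′ c (n ∸ b) * ω (a ℕ.+ c) (b ℕ.+ (n ∸ b))))
    ≡⟨ sumBox-antidiagonal J (λ b d → F a b * F′ c d * ω (a ℕ.+ c) (b ℕ.+ d))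
         (λ b d J<b+d → y≡0⇒x*y≡0 (F a b * F′ c d) (ω≡0ᴶ (a ℕ.+ c) (b ℕ.+ d) J<b+d)) ⟩
      sumBox J J (λ b d → F a b * F′ c d * ω (a ℕ.+ c) (b ℕ.+ d))
    ∎

cutoff : ℕ → ℕ → ℚ → ℚ
cutoff zero    i       x = x
cutoff (suc p) zero    x = 0ℚ
cutoff (suc p) (suc i) x = cutoff p i x

cutoff-≤ : ∀ p i x → p ≤ i → cutoff p i x ≡ x
cutoff-≤ zero    i       x _         = refl
cutoff-≤ (suc p) (suc i) x (s≤s p≤i) = cutoff-≤ p i x p≤i

cutoff-> : ∀ p i x → i < p → cutoff p i x ≡ 0ℚ
cutoff-> (suc p) zero    x _         = refl
cutoff-> (suc p) (suc i) x (s≤s i<p) = cutoff-> p i x i<p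

cutoff-0 : ∀ p i → cutoff p i 0ℚ ≡ 0ℚ
cutoff-0 zero    i       = refl
cutoff-0 (suc p) zero    = refl
cutoff-0 (suc p) (suc i) = cutoff-0 p i

+-mono-∸ : ∀ {a i c} → a ≤ i → c ≤ i ∸ a → a ℕ.+ c ≤ i
+-mono-∸ {a} a≤i c≤i∸a = transport (a ℕ.+ _ ≤_) (ℕₚ.m+[n∸m]≡n a≤i) (ℕₚ.+-monoʳ-≤ a c≤i∸a)

∸<⇒<+ : ∀ {a i c} → a ≤ i → i ∸ a < c → i < a ℕ.+ c
∸<⇒<+ {a} a≤i i∸a<c = transport (_< a ℕ.+ _) (ℕₚ.m+[n∸m]≡n a≤i) (ℕₚ.+-monoʳ-< a i∸a<c)

⊛-assoc : ∀ f g h → ((f ⊛ g) ⊛ h) ≐ (f ⊛ (g ⊛ h))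
⊛-assoc f g h i j = begin
    ((f ⊛ g) ⊛ h) i j
  ≡⟨ sumTo-cong≤ i (λ p p≤i → sumTo-cong≤ j (λ q q≤j → cong ((f ⊛ g) p q *_)
       (sym (trans (cutoff-≤ p i _ p≤i) (cutoff-≤ q j _ q≤j))))) ⟩
    sumBox i j (λ p q → (f ⊛ g) p q * ω p q)
  ≡⟨ sumBox-⊛ i j f g ω (λ k n i<k → cutoff-> k i _ i<k)
       (λ k n j<n → trans (cong (cutoff k i) (cutoff-> n j (h (i ∸ k) (j ∸ n)) j<n)) (cutoff-0 k i)) ⟩
    sumBox i j (λ a b → sumBox i j (λ c d → f a b * g c d * ω (a ℕ.+ c) (b ℕ.+ d)))
  ≡⟨ sumTo-cong≤ i (λ a a≤i → sumTo-cong≤ j (λ b b≤j → sym (inner a b a≤i b≤j))) ⟩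
    (f ⊛ (g ⊛ h)) i j
  ∎
  where
  open ≡-Reasoning
  -- h reflected into the box and extended by zero outside it, as sumBox-⊛ requires
  ω : ℕ → ℕ → ℚ
  ω p q = cutoff p i (cutoff q j (h (i ∸ p) (j ∸ q)))
  ω-inside : ∀ {a b c d} → a ≤ i → b ≤ j → c ≤ i ∸ a → d ≤ j ∸ b →
    ω (a ℕ.+ c) (b ℕ.+ d) ≡ h (i ∸ a ∸ c) (j ∸ b ∸ d)
  ω-inside {a} {b} {c} {d} a≤i b≤j c≤ d≤ =
    trans (cutoff-≤ (a ℕ.+ c) i _ (+-mono-∸ a≤i c≤))
      (trans (cutoff-≤ (b ℕ.+ d) j _ (+-mono-∸ b≤j d≤))
        (cong₂ h (sym (ℕₚ.∸-+-assoc i a c)) (sym (ℕₚ.∸-+-assoc j b d))))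
  inner : ∀ a b → a ≤ i → b ≤ j →
    f a b * (g ⊛ h) (i ∸ a) (j ∸ b) ≡ sumBox i j (λ c d → f a b * g c d * ω (a ℕ.+ c) (b ℕ.+ d))
  inner a b a≤i b≤j = begin
      f a b * (g ⊛ h) (i ∸ a) (j ∸ b)
    ≡⟨ sumTo-*ˡ (i ∸ a) (f a b) _ ⟩
      sumTo (i ∸ a) (λ c → f a b * sumTo (j ∸ b) (λ d → g c d * h (i ∸ a ∸ c) (j ∸ b ∸ d)))
    ≡⟨ sumTo-cong≤ (i ∸ a) (λ c c≤ → trans (sumTo-*ˡ (j ∸ b) (f a b) _) (sumTo-cong≤ (j ∸ b) (λ d d≤ →
         trans (sym (*-assoc (f a b) (g c d) _)) (cong (f a b * g c d *_) (sym (ω-inside a≤i b≤j c≤ d≤)))))) ⟩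
      sumBox (i ∸ a) (j ∸ b) (λ c d → f a b * g c d * ω (a ℕ.+ c) (b ℕ.+ d))
    ≡⟨ sumTo-cong≤ (i ∸ a) (λ c c≤ → sumTo-extend j _ (ℕₚ.m∸n≤m j b) (λ d j∸b<d →
         y≡0⇒x*y≡0 (f a b * g c d) (trans (cutoff-≤ (a ℕ.+ c) i _ (+-mono-∸ a≤i c≤))
                                            (cutoff-> (b ℕ.+ d) j _ (∸<⇒<+ b≤j j∸b<d))))) ⟩
      sumBox (i ∸ a) j (λ c d → f a b * g c d * ω (a ℕ.+ c) (b ℕ.+ d))
    ≡⟨ sumTo-extend i _ (ℕₚ.m∸n≤m i a) (λ c i∸a<c → sumTo-zero j _ (λ d _ →
         y≡0⇒x*y≡0 (f a b * g c d) (cutoff-> (a ℕ.+ c) i _ (∸<⇒<+ a≤i i∸a<c)))) ⟩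
      sumBox i j (λ c d → f a b * g c d * ω (a ℕ.+ c) (b ℕ.+ d))
    ∎

^ˢ-+ : ∀ f m n → (f ^ˢ (m ℕ.+ n)) ≐ ((f ^ˢ m) ⊛ (f ^ˢ n))
^ˢ-+ f zero    n = ≐-sym (⊛-identityˡ (f ^ˢ n))
^ˢ-+ f (suc m) n = ≐-trans (⊛-cong (≐-refl {f}) (^ˢ-+ f m n)) (≐-sym (⊛-assoc f (f ^ˢ m) (f ^ˢ n)))

⊛-interchange : ∀ w x y z → ((w ⊛ x) ⊛ (y ⊛ z)) ≐ ((w ⊛ y) ⊛ (x ⊛ z))
⊛-interchange w x y z = begin
    (w ⊛ x) ⊛ (y ⊛ z)  ≈⟨ ⊛-assoc w x (y ⊛ z) ⟩
    w ⊛ (x ⊛ (y ⊛ z))  ≈⟨ ⊛-cong (≐-refl {w}) (⊛-assoc x y z) ⟨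
    w ⊛ ((x ⊛ y) ⊛ z)  ≈⟨ ⊛-cong (≐-refl {w}) (⊛-cong (⊛-comm x y) (≐-refl {z})) ⟩
    w ⊛ ((y ⊛ x) ⊛ z)  ≈⟨ ⊛-cong (≐-refl {w}) (⊛-assoc y x z) ⟩
    w ⊛ (y ⊛ (x ⊛ z))  ≈⟨ ⊛-assoc w y (x ⊛ z) ⟨
    (w ⊛ y) ⊛ (x ⊛ z)  ∎
  where open ≐-Reasoning

Order≥ : ℕ → Ser → Set
Order≥ k f = ∀ i j → i ℕ.+ j < k → f i j ≡ 0ℚ

YOrder≥ : ℕ → Ser → Set
YOrder≥ k f = ∀ i j → j < k → f i j ≡ 0ℚ

order≥1 : ∀ {f} → f 0 0 ≡ 0ℚ → Order≥ 1 f
order≥1 f₀₀≡0 zero    zero    _ = f₀₀≡0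
order≥1 f₀₀≡0 (suc i) zero    (s≤s ())
order≥1 f₀₀≡0 zero    (suc j) (s≤s ())
order≥1 f₀₀≡0 (suc i) (suc j) (s≤s ())

yOrder≥1⇒order≥1 : ∀ {f} → YOrder≥ 1 f → Order≥ 1 f
yOrder≥1⇒order≥1 f≡0 = order≥1 (f≡0 0 0 (s≤s z≤n))

order≥-⊛ : ∀ {k l f g} → Order≥ k f → Order≥ l g → Order≥ (k ℕ.+ l) (f ⊛ g)
order≥-⊛ {k} {l} {f} {g} f≡0 g≡0 i j i+j<k+l = sumBox-zero i j _ term
  where
  degree-split : ∀ a b → a ≤ i → b ≤ j → (i ∸ a) ℕ.+ (j ∸ b) ℕ.+ (a ℕ.+ b) ≡ i ℕ.+ j
  degree-split a b a≤i b≤j =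
    trans (ℕ-+-interchange (i ∸ a) (j ∸ b) a b) (cong₂ ℕ._+_ (ℕₚ.m∸n+n≡m a≤i) (ℕₚ.m∸n+n≡m b≤j))
  term : ∀ a b → a ≤ i → b ≤ j → f a b * g (i ∸ a) (j ∸ b) ≡ 0ℚ
  term a b a≤i b≤j with a ℕ.+ b ℕₚ.<? k
  ... | yes a+b<k = x≡0⇒x*y≡0 (g (i ∸ a) (j ∸ b)) (f≡0 a b a+b<k)
  ... | no  a+b≮k = y≡0⇒x*y≡0 (f a b) (g≡0 (i ∸ a) (j ∸ b)
        (ℕₚ.+-cancelʳ-< (a ℕ.+ b) _ l
          (transport (_< l ℕ.+ (a ℕ.+ b)) (sym (degree-split a b a≤i b≤j))
            (ℕₚ.<-≤-trans i+j<k+l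
               (transport (k ℕ.+ l ≤_) (ℕₚ.+-comm (a ℕ.+ b) l) (ℕₚ.+-monoˡ-≤ l (ℕₚ.≮⇒≥ a+b≮k)))))))

yOrder≥-⊛ : ∀ {k l f g} → YOrder≥ k f → YOrder≥ l g → YOrder≥ (k ℕ.+ l) (f ⊛ g)
yOrder≥-⊛ {k} {l} {f} {g} f≡0 g≡0 i j j<k+l = sumBox-zero i j _ term
  where
  term : ∀ a b → a ≤ i → b ≤ j → f a b * g (i ∸ a) (j ∸ b) ≡ 0ℚ
  term a b _ b≤j with b ℕₚ.<? k
  ... | yes b<k = x≡0⇒x*y≡0 (g (i ∸ a) (j ∸ b)) (f≡0 a b b<k)
  ... | no  b≮k = y≡0⇒x*y≡0 (f a b) (g≡0 (i ∸ a) (j ∸ b)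
        (ℕₚ.+-cancelʳ-< b _ l
          (transport (_< l ℕ.+ b) (sym (ℕₚ.m∸n+n≡m b≤j))
            (ℕₚ.<-≤-trans j<k+l
               (transport (k ℕ.+ l ≤_) (ℕₚ.+-comm b l) (ℕₚ.+-monoˡ-≤ l (ℕₚ.≮⇒≥ b≮k)))))))

order≥-^ˢ : ∀ {f} → Order≥ 1 f → ∀ m → Order≥ m (f ^ˢ m)
order≥-^ˢ f≡0 zero    = λ _ _ ()
order≥-^ˢ f≡0 (suc m) = order≥-⊛ {1} {m} f≡0 (order≥-^ˢ f≡0 m)

yOrder≥-^ˢ : ∀ {f} → YOrder≥ 1 f → ∀ m → YOrder≥ m (f ^ˢ m)
yOrder≥-^ˢ f≡0 zero    = λ _ _ ()
yOrder≥-^ˢ f≡0 (suc m) = yOrder≥-⊛ {1} {m} f≡0 (yOrder≥-^ˢ f≡0 m)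

⊛-lowest-y : ∀ {p q f g} → YOrder≥ p f → YOrder≥ q g → ∀ i →
  (f ⊛ g) i (p ℕ.+ q) ≡ sumTo i (λ a → f a p * g (i ∸ a) q)
⊛-lowest-y {p} {q} {f} {g} f≡0 g≡0 i = sumTo-cong i (λ a →
  trans (sumTo-single (p ℕ.+ q) p _ (ℕₚ.m≤m+n p q) (term a))
        (cong (λ z → f a p * g (i ∸ a) z) (ℕₚ.m+n∸m≡n p q)))
  where
  term : ∀ a b → b ≤ p ℕ.+ q → b ≢ p → f a b * g (i ∸ a) (p ℕ.+ q ∸ b) ≡ 0ℚ
  term a b b≤p+q b≢p with ℕₚ.<-cmp b p
  ... | tri< b<p _ _ = x≡0⇒x*y≡0 (g (i ∸ a) (p ℕ.+ q ∸ b)) (f≡0 a b b<p)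
  ... | tri≈ _ b≡p _ = ⊥-elim (b≢p b≡p)
  ... | tri> _ _ p<b = y≡0⇒x*y≡0 (f a b) (g≡0 (i ∸ a) _
          (ℕₚ.+-cancelʳ-< b _ q (transport (_< q ℕ.+ b) (sym (ℕₚ.m∸n+n≡m b≤p+q))
             (transport (p ℕ.+ q <_) (ℕₚ.+-comm b q) (ℕₚ.+-monoˡ-< q p<b)))))

_≐_mod-y : Ser → Ser → Set
f ≐ g mod-y = ∀ i → f i 0 ≡ g i 0

⊛-cong-mod-y : ∀ {f f′ g g′} → f ≐ f′ mod-y → g ≐ g′ mod-y → (f ⊛ g) ≐ (f′ ⊛ g′) mod-y
⊛-cong-mod-y f≐f′ g≐g′ i = sumTo-cong i (λ a → cong₂ _*_ (f≐f′ a) (g≐g′ (i ∸ a)))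

^ˢ-cong-mod-y : ∀ {f f′} → f ≐ f′ mod-y → ∀ m → (f ^ˢ m) ≐ (f′ ^ˢ m) mod-y
^ˢ-cong-mod-y f≐f′ zero    i = refl
^ˢ-cong-mod-y {f} {f′} f≐f′ (suc m) =
  ⊛-cong-mod-y {f} {f′} {f ^ˢ m} {f′ ^ˢ m} f≐f′ (^ˢ-cong-mod-y f≐f′ m)

δ : ℕ → ℕ → ℚ
δ k i = if i ℕ.≡ᵇ k then 1ℚ else 0ℚ

monomial : ℕ → ℕ → Ser
monomial k n i j = if (i ℕ.≡ᵇ k) ∧ (j ℕ.≡ᵇ n) then 1ℚ else 0ℚ

monomial-δ : ∀ k n i j → monomial k n i j ≡ δ k i * δ n j
monomial-δ k n i j = if-∧ (i ℕ.≡ᵇ k) (j ℕ.≡ᵇ n)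
  where
  if-∧ : ∀ x y → (if x ∧ y then 1ℚ else 0ℚ) ≡ (if x then 1ℚ else 0ℚ) * (if y then 1ℚ else 0ℚ)
  if-∧ true  true  = refl
  if-∧ true  false = refl
  if-∧ false true  = refl
  if-∧ false false = refl

δ-refl : ∀ k → δ k k ≡ 1ℚ
δ-refl zero    = refl
δ-refl (suc k) = δ-refl k

δ-≢ : ∀ k i → i ≢ k → δ k i ≡ 0ℚ
δ-≢ zero    zero    i≢k = ⊥-elim (i≢k refl)
δ-≢ (suc k) zero    _   = refl
δ-≢ zero    (suc i) _   = refl
δ-≢ (suc k) (suc i) i≢k = δ-≢ k i (λ i≡k → i≢k (cong suc i≡k))

δ-∸ : ∀ a c i → a ≤ i → δ c (i ∸ a) ≡ δ (a ℕ.+ c) i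
δ-∸ zero    c i       _         = refl
δ-∸ (suc a) c (suc i) (s≤s a≤i) = δ-∸ a c i a≤i

monomial-refl : ∀ k n → monomial k n k n ≡ 1ℚ
monomial-refl k n = trans (monomial-δ k n k n) (cong₂ _*_ (δ-refl k) (δ-refl n))

monomial-≢ˡ : ∀ k n i j → i ≢ k → monomial k n i j ≡ 0ℚ
monomial-≢ˡ k n i j i≢k = trans (monomial-δ k n i j) (x≡0⇒x*y≡0 (δ n j) (δ-≢ k i i≢k))

monomial-≢ʳ : ∀ k n i j → j ≢ n → monomial k n i j ≡ 0ℚ
monomial-≢ʳ k n i j j≢n = trans (monomial-δ k n i j) (y≡0⇒x*y≡0 (δ k i) (δ-≢ n j j≢n))

monomial-⊛ : ∀ k n f i j → k ≤ i → n ≤ j → (monomial k n ⊛ f) i j ≡ f (i ∸ k) (j ∸ n)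
monomial-⊛ k n f i j k≤i n≤j =
  trans (sumTo-single i k _ k≤i (λ a _ a≢k → sumTo-zero j _ (λ b _ →
           x≡0⇒x*y≡0 (f (i ∸ a) (j ∸ b)) (monomial-≢ˡ k n a b a≢k))))
  (trans (sumTo-single j n _ n≤j (λ b _ b≢n →
           x≡0⇒x*y≡0 (f (i ∸ k) (j ∸ b)) (monomial-≢ʳ k n k b b≢n)))
         (trans (cong (_* f (i ∸ k) (j ∸ n)) (monomial-refl k n)) (*-identityˡ _)))

monomial-⊛-outside : ∀ k n f i j → i < k ⊎ j < n → (monomial k n ⊛ f) i j ≡ 0ℚ
monomial-⊛-outside k n f i j outside = sumBox-zero i j _ (λ a b a≤i b≤j →
  x≡0⇒x*y≡0 (f (i ∸ a) (j ∸ b)) (vanish a b a≤i b≤j outside))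
  where
  vanish : ∀ a b → a ≤ i → b ≤ j → i < k ⊎ j < n → monomial k n a b ≡ 0ℚ
  vanish a b a≤i _ (inj₁ i<k) =
    monomial-≢ˡ k n a b (λ { refl → ℕₚ.<-irrefl refl (ℕₚ.≤-<-trans a≤i i<k) })
  vanish a b _ b≤j (inj₂ j<n) =
    monomial-≢ʳ k n a b (λ { refl → ℕₚ.<-irrefl refl (ℕₚ.≤-<-trans b≤j j<n) })

monomial-⊛-monomial : ∀ a b c d → (monomial a b ⊛ monomial c d) ≐ monomial (a ℕ.+ c) (b ℕ.+ d)
monomial-⊛-monomial a b c d i j with a ℕₚ.≤? i | b ℕₚ.≤? j
... | yes a≤i | yes b≤j =
  trans (monomial-⊛ a b (monomial c d) i j a≤i b≤j)
  (trans (monomial-δ c d (i ∸ a) (j ∸ b))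
  (trans (cong₂ _*_ (δ-∸ a c i a≤i) (δ-∸ b d j b≤j)) (sym (monomial-δ (a ℕ.+ c) (b ℕ.+ d) i j))))
... | no a≰i | _ =
  trans (monomial-⊛-outside a b (monomial c d) i j (inj₁ (ℕₚ.≰⇒> a≰i)))
        (sym (monomial-≢ˡ (a ℕ.+ c) (b ℕ.+ d) i j (λ { refl → a≰i (ℕₚ.m≤m+n a c) })))
... | yes _ | no b≰j =
  trans (monomial-⊛-outside a b (monomial c d) i j (inj₂ (ℕₚ.≰⇒> b≰j)))
        (sym (monomial-≢ʳ (a ℕ.+ c) (b ℕ.+ d) i j (λ { refl → b≰j (ℕₚ.m≤m+n b d) })))

Xs^ˢ⊛Ys^ˢ : ∀ k n → ((Xs ^ˢ k) ⊛ (Ys ^ˢ n)) ≐ monomial k n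
Xs^ˢ⊛Ys^ˢ k n = ≐-trans (⊛-cong (Xs^ˢ k) (Ys^ˢ n))
  (≐-trans (monomial-⊛-monomial k 0 0 n) (λ i j → cong (λ z → monomial z n i j) (ℕₚ.+-identityʳ k)))
  where
  Xs^ˢ : ∀ k → (Xs ^ˢ k) ≐ monomial k 0
  Xs^ˢ zero    = ≐-refl
  Xs^ˢ (suc k) = ≐-trans (⊛-cong (≐-refl {Xs}) (Xs^ˢ k)) (monomial-⊛-monomial 1 0 k 0)
  Ys^ˢ : ∀ n → (Ys ^ˢ n) ≐ monomial 0 n
  Ys^ˢ zero    = ≐-refl
  Ys^ˢ (suc n) = ≐-trans (⊛-cong (≐-refl {Ys}) (Ys^ˢ n)) (monomial-⊛-monomial 0 1 0 n)

⊛-sumTo : ∀ K (F : Ser) (G : ℕ → Ser) i j →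
  (F ⊛ (λ x y → sumTo K (λ m → G m x y))) i j ≡ sumTo K (λ m → (F ⊛ G m) i j)
⊛-sumTo K F G i j =
  trans (sumTo-cong i (λ a → trans (sumTo-cong j (λ b → sumTo-*ˡ K (F a b) _)) (sumTo-swap j K _)))
        (sumTo-swap i K _)

-- With D = 1 - F, F ⊛ D^m = D^m - D^(m+1) telescopes, and D^m vanishes in degrees below m.
⊛-inverseʳ : ∀ F → F 0 0 ≡ 1ℚ → (F ⊛ inv F) ≐ const 1ℚ
⊛-inverseʳ F F₀₀≡1 i j = begin
    (F ⊛ inv F) i j
  ≡⟨ sumBox-cong i j (λ a b → cong (F a b *_) (sumTo-extend (i ℕ.+ j) _
       (ℕₚ.+-mono-≤ (ℕₚ.m∸n≤m i a) (ℕₚ.m∸n≤m j b)) (λ m lt → order≥-^ˢ D-order m _ _ lt))) ⟩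
    (F ⊛ (λ x y → sumTo K (λ m → (D ^ˢ m) x y))) i j
  ≡⟨ ⊛-sumTo K F (D ^ˢ_) i j ⟩
    sumTo K (λ m → (F ⊛ (D ^ˢ m)) i j)
  ≡⟨ sumTo-cong K (λ m → F⊛D^ˢ m) ⟩
    sumTo K (λ m → (D ^ˢ m) i j - (D ^ˢ suc m) i j)
  ≡⟨ sumTo-telescope K (λ m → (D ^ˢ m) i j) ⟩
    const 1ℚ i j - (D ^ˢ suc K) i j
  ≡⟨ cong (λ z → const 1ℚ i j - z) (order≥-^ˢ D-order (suc K) i j ℕₚ.≤-refl) ⟩
    const 1ℚ i j - 0ℚ
  ≡⟨ +-identityʳ _ ⟩
    const 1ℚ i j
  ∎
  where
  open ≡-Reasoning
  K = i ℕ.+ j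
  D = const 1ℚ ⊖ F
  D-order : Order≥ 1 D
  D-order = order≥1 (cong (λ z → 1ℚ - z) F₀₀≡1)
  F≐1-D : F ≐ (const 1ℚ ⊖ D)
  F≐1-D x y = sym (solve 2 (λ c f → c :- (c :- f) := f) refl (const 1ℚ x y) (F x y))
  F⊛D^ˢ : ∀ m → (F ⊛ (D ^ˢ m)) i j ≡ (D ^ˢ m) i j - (D ^ˢ suc m) i j
  F⊛D^ˢ m = trans (⊛-cong F≐1-D (≐-refl {D ^ˢ m}) i j)
    (trans (⊛-distribʳ-⊖ (D ^ˢ m) (const 1ℚ) D i j)
           (cong (_- (D ^ˢ suc m) i j) (⊛-identityˡ (D ^ˢ m) i j)))

⊛-cancel : ∀ F G → F 0 0 ≡ 1ℚ → (F ⊛ (G ⊛ inv F)) ≐ G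
⊛-cancel F G F₀₀≡1 = begin
    F ⊛ (G ⊛ inv F)    ≈⟨ ⊛-assoc F G (inv F) ⟨
    (F ⊛ G) ⊛ inv F    ≈⟨ ⊛-cong (⊛-comm F G) (≐-refl {inv F}) ⟩
    (G ⊛ F) ⊛ inv F    ≈⟨ ⊛-assoc G F (inv F) ⟩
    G ⊛ (F ⊛ inv F)    ≈⟨ ⊛-cong (≐-refl {G}) (⊛-inverseʳ F F₀₀≡1) ⟩
    G ⊛ const 1ℚ       ≈⟨ ⊛-identityʳ G ⟩
    G                  ∎
  where open ≐-Reasoning

Admissible : Ser → Ser → Set
Admissible G H = Order≥ 1 G × YOrder≥ 1 H

powers : Ser → Ser → ℕ → ℕ → Ser
powers G H k n = (G ^ˢ k) ⊛ (H ^ˢ n)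

powers-order≥ : ∀ {G H} → Admissible G H → ∀ k n → Order≥ (k ℕ.+ n) (powers G H k n)
powers-order≥ (G≡0 , H≡0) k n =
  order≥-⊛ {k} {n} (order≥-^ˢ G≡0 k) (order≥-^ˢ (yOrder≥1⇒order≥1 H≡0) n)

powers-yOrder≥ : ∀ {G H} → Admissible G H → ∀ k n → YOrder≥ n (powers G H k n)
powers-yOrder≥ {G} (_ , H≡0) k n = yOrder≥-⊛ {0} {n} {G ^ˢ k} (λ _ _ ()) (yOrder≥-^ˢ H≡0 n)

powers-⊛ : ∀ G H a b c d → (powers G H a b ⊛ powers G H c d) ≐ powers G H (a ℕ.+ c) (b ℕ.+ d)
powers-⊛ G H a b c d =
  ≐-trans (⊛-interchange (G ^ˢ a) (H ^ˢ b) (G ^ˢ c) (H ^ˢ d))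
          (⊛-cong (≐-sym (^ˢ-+ G a c)) (≐-sym (^ˢ-+ H b d)))

subst-sumBox : ∀ {G H} → Admissible G H → ∀ F i j K → i ℕ.+ j ≤ K →
  subst F G H i j ≡ sumBox K K (λ k n → F k n * powers G H k n i j)
subst-sumBox adm F i j K i+j≤K =
  trans (sumTo-cong≤ j (λ n n≤j → sumTo-extend K _ i+j≤K (λ k i+j<k →
           y≡0⇒x*y≡0 (F k n) (powers-order≥ adm k n i j (ℕₚ.<-≤-trans i+j<k (ℕₚ.m≤m+n k n))))))
  (trans (sumTo-extend K _ (ℕₚ.≤-trans (ℕₚ.m≤n+m j i) i+j≤K) (λ n j<n → sumTo-zero K _ (λ k _ →
           y≡0⇒x*y≡0 (F k n) (powers-yOrder≥ adm k n i j j<n))))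
         (sumTo-swap K K _))

subst-congˡ : ∀ {F F′} G H → F ≐ F′ → subst F G H ≐ subst F′ G H
subst-congˡ G H F≐F′ i j =
  sumTo-cong j (λ n → sumTo-cong (i ℕ.+ j) (λ k → cong (_* powers G H k n i j) (F≐F′ k n)))

subst-congʳ : ∀ F {G G′ H H′} → G ≐ G′ → H ≐ H′ → subst F G H ≐ subst F G′ H′
subst-congʳ F G≐G′ H≐H′ i j = sumTo-cong j (λ n → sumTo-cong (i ℕ.+ j) (λ k →
  cong (F k n *_) (⊛-cong (^ˢ-cong G≐G′ k) (^ˢ-cong H≐H′ n) i j)))

subst-⊕ : ∀ F F′ G H → subst (F ⊕ F′) G H ≐ (subst F G H ⊕ subst F′ G H)
subst-⊕ F F′ G H i j =
  trans (sumTo-cong j (λ n → trans (sumTo-cong (i ℕ.+ j) (λ k → *-distribʳ-+ (powers G H k n i j) (F k n) (F′ k n)))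
                                   (sumTo-+ (i ℕ.+ j) _ _)))
        (sumTo-+ j _ _)

subst-⊖ : ∀ F F′ G H → subst (F ⊖ F′) G H ≐ (subst F G H ⊖ subst F′ G H)
subst-⊖ F F′ G H i j =
  trans (sumTo-cong j (λ n → trans (sumTo-cong (i ℕ.+ j) (λ k → [y-z]x≈yx-zx (powers G H k n i j) (F k n) (F′ k n)))
                                   (sumTo-- (i ℕ.+ j) _ _)))
        (sumTo-- j _ _)

_·_ : ℚ → Ser → Ser
(c · F) i j = c * F i j

subst-· : ∀ c F G H → subst (c · F) G H ≐ (c · subst F G H)
subst-· c F G H i j =
  sym (trans (sumTo-*ˡ j c _) (sumTo-cong j (λ n → trans (sumTo-*ˡ (i ℕ.+ j) c _)
    (sumTo-cong (i ℕ.+ j) (λ k → sym (*-assoc c (F k n) _))))))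

subst-monomial : ∀ {G H} → Admissible G H → ∀ a b → subst (monomial a b) G H ≐ powers G H a b
subst-monomial {G} {H} adm a b i j =
  trans (subst-sumBox adm (monomial a b) i j K (ℕₚ.m≤n+m (i ℕ.+ j) (a ℕ.+ b)))
  (trans (sumTo-single K a _ (ℕₚ.≤-trans (ℕₚ.m≤m+n a b) (ℕₚ.m≤m+n (a ℕ.+ b) (i ℕ.+ j)))
            (λ k _ k≢a → sumTo-zero K _ (λ n _ → x≡0⇒x*y≡0 (powers G H k n i j) (monomial-≢ˡ a b k n k≢a))))
  (trans (sumTo-single K b _ (ℕₚ.≤-trans (ℕₚ.m≤n+m b a) (ℕₚ.m≤m+n (a ℕ.+ b) (i ℕ.+ j)))
            (λ n _ n≢b → x≡0⇒x*y≡0 (powers G H a n i j) (monomial-≢ʳ a b a n n≢b)))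
         (trans (cong (_* powers G H a b i j) (monomial-refl a b)) (*-identityˡ _))))
  where
  K = a ℕ.+ b ℕ.+ (i ℕ.+ j)

subst-const : ∀ {G H} → Admissible G H → ∀ c → subst (const c) G H ≐ const c
subst-const {G} {H} adm c = begin
    subst (const c) G H            ≈⟨ subst-congˡ G H const≐monomial ⟩
    subst (c · monomial 0 0) G H   ≈⟨ subst-· c (monomial 0 0) G H ⟩
    c · subst (monomial 0 0) G H   ≈⟨ (λ i j → cong (c *_) (subst-monomial adm 0 0 i j)) ⟩
    c · (const 1ℚ ⊛ const 1ℚ)      ≈⟨ (λ i j → cong (c *_) (⊛-identityˡ (const 1ℚ) i j)) ⟩
    c · monomial 0 0               ≈⟨ const≐monomial ⟨
    const c                        ∎
  where
  open ≐-Reasoning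
  const≐monomial : const c ≐ (c · monomial 0 0)
  const≐monomial zero    zero    = sym (*-identityʳ c)
  const≐monomial zero    (suc j) = sym (*-zeroʳ c)
  const≐monomial (suc i) j       = sym (*-zeroʳ c)

subst-Xs : ∀ {G H} → Admissible G H → subst Xs G H ≐ G
subst-Xs {G} {H} adm =
  ≐-trans (subst-monomial adm 1 0) (≐-trans (⊛-identityʳ (G ⊛ const 1ℚ)) (⊛-identityʳ G))

subst-Ys : ∀ {G H} → Admissible G H → subst Ys G H ≐ H
subst-Ys {G} {H} adm =
  ≐-trans (subst-monomial adm 0 1) (≐-trans (⊛-identityˡ (H ⊛ const 1ℚ)) (⊛-identityʳ H))

Ys-yOrder≥1 : YOrder≥ 1 Ys
Ys-yOrder≥1 zero    zero    _ = refl
Ys-yOrder≥1 (suc i) zero    _ = refl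
Ys-yOrder≥1 i       (suc j) (s≤s ())

Admissible-Xs-Ys : Admissible Xs Ys
Admissible-Xs-Ys = order≥1 refl , Ys-yOrder≥1

subst-id : ∀ F → subst F Xs Ys ≐ F
subst-id F i j =
  trans (subst-sumBox Admissible-Xs-Ys F i j K ℕₚ.≤-refl)
  (trans (sumBox-cong K K (λ k n → cong (F k n *_) (Xs^ˢ⊛Ys^ˢ k n i j)))
  (trans (sumTo-single K i _ (ℕₚ.m≤m+n i j) (λ k _ k≢i → sumTo-zero K _ (λ n _ →
            y≡0⇒x*y≡0 (F k n) (monomial-≢ˡ k n i j (λ i≡k → k≢i (sym i≡k))))))
  (trans (sumTo-single K j _ (ℕₚ.m≤n+m j i) (λ n _ n≢j →
            y≡0⇒x*y≡0 (F i n) (monomial-≢ʳ i n i j (λ j≡n → n≢j (sym j≡n)))))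
         (trans (cong (F i j *_) (monomial-refl i j)) (*-identityʳ _)))))
  where
  K = i ℕ.+ j

subst-⊛ : ∀ {G H} → Admissible G H → ∀ F F′ → subst (F ⊛ F′) G H ≐ (subst F G H ⊛ subst F′ G H)
subst-⊛ {G} {H} adm F F′ i j = begin
    subst (F ⊛ F′) G H i j
  ≡⟨ subst-sumBox adm (F ⊛ F′) i j K ℕₚ.≤-refl ⟩
    sumBox K K (λ k n → (F ⊛ F′) k n * P k n i j)
  ≡⟨ sumBox-⊛ K K F F′ (λ k n → P k n i j)
       (λ k n K<k → powers-order≥ adm k n i j (ℕₚ.<-≤-trans K<k (ℕₚ.m≤m+n k n)))
       (λ k n K<n → powers-order≥ adm k n i j (ℕₚ.<-≤-trans K<n (ℕₚ.m≤n+m n k))) ⟩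
    sumBox K K (λ a b → sumBox K K (λ c d → F a b * F′ c d * P (a ℕ.+ c) (b ℕ.+ d) i j))
  ≡⟨ sumBox-cong K K (λ a b → sumBox-cong K K (λ c d → sym (split-powers a b c d))) ⟩
    sumBox K K (λ a b → sumBox K K (λ c d → sumBox i j (λ p q → X p q a b c d)))
  ≡⟨ sumBox-cong K K (λ a b → sumBox-swap K K i j (λ c d p q → X p q a b c d)) ⟩
    sumBox K K (λ a b → sumBox i j (λ p q → sumBox K K (X p q a b)))
  ≡⟨ sumBox-swap K K i j (λ a b p q → sumBox K K (X p q a b)) ⟩
    sumBox i j (λ p q → sumBox K K (λ a b → sumBox K K (X p q a b)))
  ≡⟨ sumTo-cong≤ i (λ p p≤i → sumTo-cong≤ j (λ q q≤j → sym (trans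
       (cong₂ _*_ (subst-sumBox adm F p q K (ℕₚ.+-mono-≤ p≤i q≤j))
                  (subst-sumBox adm F′ (i ∸ p) (j ∸ q) K (ℕₚ.+-mono-≤ (ℕₚ.m∸n≤m i p) (ℕₚ.m∸n≤m j q))))
       (sumBox-* K K K K (λ a b → F a b * P a b p q) (λ c d → F′ c d * P c d (i ∸ p) (j ∸ q)))))) ⟩
    (subst F G H ⊛ subst F′ G H) i j
  ∎
  where
  open ≡-Reasoning
  K = i ℕ.+ j
  P = powers G H
  X : ℕ → ℕ → ℕ → ℕ → ℕ → ℕ → ℚ
  X p q a b c d = (F a b * P a b p q) * (F′ c d * P c d (i ∸ p) (j ∸ q))
  split-powers : ∀ a b c d → sumBox i j (λ p q → X p q a b c d) ≡ F a b * F′ c d * P (a ℕ.+ c) (b ℕ.+ d) i j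
  split-powers a b c d =
    trans (sumBox-cong i j (λ p q → *-interchange (F a b) (P a b p q) (F′ c d) (P c d (i ∸ p) (j ∸ q))))
    (trans (sym (trans (sumTo-*ˡ i (F a b * F′ c d) _) (sumTo-cong i (λ p → sumTo-*ˡ j (F a b * F′ c d) _))))
           (cong (F a b * F′ c d *_) (powers-⊛ G H a b c d i j)))

subst-^ˢ : ∀ {G H} → Admissible G H → ∀ F m → subst (F ^ˢ m) G H ≐ (subst F G H ^ˢ m)
subst-^ˢ adm F zero    = subst-const adm 1ℚ
subst-^ˢ {G} {H} adm F (suc m) =
  ≐-trans (subst-⊛ adm F (F ^ˢ m)) (⊛-cong (≐-refl {subst F G H}) (subst-^ˢ adm F m))

subst-powers : ∀ {G H} → Admissible G H → ∀ G′ H′ k n →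
  subst (powers G′ H′ k n) G H ≐ powers (subst G′ G H) (subst H′ G H) k n
subst-powers adm G′ H′ k n =
  ≐-trans (subst-⊛ adm (G′ ^ˢ k) (H′ ^ˢ n)) (⊛-cong (subst-^ˢ adm G′ k) (subst-^ˢ adm H′ n))

Admissible-subst : ∀ {G H} G′ H′ → Admissible G H → Admissible (subst G G′ H′) (subst H G′ H′)
Admissible-subst {G} {H} G′ H′ (G≡0 , H≡0) =
  order≥1 (x≡0⇒x*y≡0 (powers G′ H′ 0 0 0 0) (G≡0 0 0 (s≤s z≤n))) , H[G′,H′]≡0
  where
  H[G′,H′]≡0 : YOrder≥ 1 (subst H G′ H′)
  H[G′,H′]≡0 i zero    _ =
    sumTo-zero (i ℕ.+ 0) _ (λ k _ → x≡0⇒x*y≡0 (powers G′ H′ k 0 i 0) (H≡0 k 0 (s≤s z≤n)))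
  H[G′,H′]≡0 i (suc j) (s≤s ())

subst-subst : ∀ {G H G′ H′} → Admissible G H → Admissible G′ H′ → ∀ F →
  subst (subst F G H) G′ H′ ≐ subst F (subst G G′ H′) (subst H G′ H′)
subst-subst {G} {H} {G′} {H′} adm adm′ F i j = begin
    subst (subst F G H) G′ H′ i j
  ≡⟨ subst-sumBox adm′ (subst F G H) i j K ℕₚ.≤-refl ⟩
    sumBox K K (λ k n → subst F G H k n * P′ k n i j)
  ≡⟨ sumBox-cong K K expand ⟩
    sumBox K K (λ k n → sumBox K K (λ k′ n′ → F k′ n′ * (P k′ n′ k n * P′ k n i j)))
  ≡⟨ sumBox-swap K K K K _ ⟩
    sumBox K K (λ k′ n′ → sumBox K K (λ k n → F k′ n′ * (P k′ n′ k n * P′ k n i j)))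
  ≡⟨ sumBox-cong K K (λ k′ n′ → trans
        (sym (trans (sumTo-*ˡ K (F k′ n′) _) (sumTo-cong K (λ k → sumTo-*ˡ K (F k′ n′) _))))
        (cong (F k′ n′ *_) (trans (sym (subst-sumBox adm′ (P k′ n′) i j K ℕₚ.≤-refl))
                                  (subst-powers adm′ G H k′ n′ i j)))) ⟩
    sumBox K K (λ k′ n′ → F k′ n′ * powers (subst G G′ H′) (subst H G′ H′) k′ n′ i j)
  ≡⟨ sym (subst-sumBox (Admissible-subst G′ H′ adm) F i j K ℕₚ.≤-refl) ⟩
    subst F (subst G G′ H′) (subst H G′ H′) i j
  ∎
  where
  open ≡-Reasoning
  K = i ℕ.+ j
  P = powers G H
  P′ = powers G′ H′
  expand : ∀ k n → subst F G H k n * P′ k n i j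
         ≡ sumBox K K (λ k′ n′ → F k′ n′ * (P k′ n′ k n * P′ k n i j))
  expand k n with k ℕ.+ n ℕₚ.≤? K
  ... | yes k+n≤K =
    trans (cong (_* P′ k n i j) (subst-sumBox adm F k n K k+n≤K))
      (trans (sumTo-*ʳ K _ _) (sumTo-cong K (λ k′ → trans (sumTo-*ʳ K _ _)
        (sumTo-cong K (λ n′ → *-assoc (F k′ n′) _ _)))))
  ... | no k+n≰K =
    trans (y≡0⇒x*y≡0 (subst F G H k n) P′≡0)
      (sym (sumBox-zero K K _ (λ k′ n′ _ _ → y≡0⇒x*y≡0 (F k′ n′) (y≡0⇒x*y≡0 (P k′ n′ k n) P′≡0))))
    where
    P′≡0 : P′ k n i j ≡ 0ℚ
    P′≡0 = powers-order≥ adm′ k n i j (ℕₚ.≰⇒> k+n≰K)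

-- Substitutions with G ≡ x mod y and H ≡ y mod y² are triangular in y with unit diagonal.

^ˢ-lowest-y : ∀ {H} → YOrder≥ 1 H → (∀ i → H i 1 ≡ Ys i 1) → ∀ n i → (H ^ˢ n) i n ≡ (Ys ^ˢ n) i n
^ˢ-lowest-y H≡0 H₁≡1 zero    i = refl
^ˢ-lowest-y {H} H≡0 H₁≡1 (suc n) i =
  trans (⊛-lowest-y {1} {n} {H} {H ^ˢ n} H≡0 (yOrder≥-^ˢ H≡0 n) i)
  (trans (sumTo-cong i (λ a → cong₂ _*_ (H₁≡1 a) (^ˢ-lowest-y H≡0 H₁≡1 n (i ∸ a))))
         (sym (⊛-lowest-y {1} {n} {Ys} {Ys ^ˢ n} Ys-yOrder≥1 (yOrder≥-^ˢ Ys-yOrder≥1 n) i)))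

powers-lowest-y : ∀ {G H} → Admissible G H → G ≐ Xs mod-y → (∀ i → H i 1 ≡ Ys i 1) →
  ∀ k n i → powers G H k n i n ≡ monomial k n i n
powers-lowest-y {G} {H} (_ , H≡0) G≐x H₁≡1 k n i =
  trans (⊛-lowest-y {0} {n} {G ^ˢ k} {H ^ˢ n} (λ _ _ ()) (yOrder≥-^ˢ H≡0 n) i)
  (trans (sumTo-cong i (λ a → cong₂ _*_ (^ˢ-cong-mod-y {G} {Xs} G≐x k a) (^ˢ-lowest-y H≡0 H₁≡1 n (i ∸ a))))
  (trans (sym (⊛-lowest-y {0} {n} {Xs ^ˢ k} {Ys ^ˢ n} (λ _ _ ()) (yOrder≥-^ˢ Ys-yOrder≥1 n) i))
         (Xs^ˢ⊛Ys^ˢ k n i n)))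

subst-lowest-y : ∀ {G H} → Admissible G H → G ≐ Xs mod-y → (∀ i → H i 1 ≡ Ys i 1) →
  ∀ F j → YOrder≥ j F → ∀ i → subst F G H i j ≡ F i j
subst-lowest-y {G} {H} adm G≐x H₁≡1 F j F≡0 i =
  trans (sumTo-single j j _ ℕₚ.≤-refl (λ n n≤j n≢j → sumTo-zero (i ℕ.+ j) _ (λ k _ →
           x≡0⇒x*y≡0 (powers G H k n i j) (F≡0 k n (ℕₚ.≤∧≢⇒< n≤j n≢j)))))
  (trans (sumTo-single (i ℕ.+ j) i _ (ℕₚ.m≤m+n i j) (λ k _ k≢i →
           y≡0⇒x*y≡0 (F k j) (trans (powers-lowest-y adm G≐x H₁≡1 k j i)
                                    (monomial-≢ˡ k j i j (λ i≡k → k≢i (sym i≡k))))))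
  (trans (cong (F i j *_) (trans (powers-lowest-y adm G≐x H₁≡1 i j i) (monomial-refl i j)))
         (*-identityʳ _)))

subst-injective : ∀ {G H} → Admissible G H → G ≐ Xs mod-y → (∀ i → H i 1 ≡ Ys i 1) →
  ∀ F F′ → subst F G H ≐ subst F′ G H → F ≐ F′
subst-injective {G} {H} adm G≐x H₁≡1 F F′ F[G,H]≐F′[G,H] i j =
  trans (solve 2 (λ x y → x := (x :- y) :+ y) refl (F i j) (F′ i j))
        (trans (cong (_+ F′ i j) (D-yOrder≥ (suc j) i j ℕₚ.≤-refl)) (+-identityˡ _))
  where
  D = F ⊖ F′
  D[G,H]≡0 : ∀ x y → subst D G H x y ≡ 0ℚ
  D[G,H]≡0 x y = trans (subst-⊖ F F′ G H x y)
    (trans (cong (_- subst F′ G H x y) (F[G,H]≐F′[G,H] x y)) (+-inverseʳ (subst F′ G H x y)))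
  D-yOrder≥ : ∀ n → YOrder≥ n D
  D-yOrder≥ zero    _ _ ()
  D-yOrder≥ (suc n) k m (s≤s m≤n) with ℕₚ.m≤n⇒m<n∨m≡n m≤n
  ... | inj₁ m<n  = D-yOrder≥ n k m m<n
  ... | inj₂ refl = trans (sym (subst-lowest-y adm G≐x H₁≡1 D m (D-yOrder≥ m) k)) (D[G,H]≡0 k m)

-- Only the empty walk has length 0.
Q≐1-mod-y : Q ≐ const 1ℚ mod-y
Q≐1-mod-y zero    = refl
Q≐1-mod-y (suc k) = refl

inv-≐1-mod-y : ∀ {F} → F ≐ const 1ℚ mod-y → inv F ≐ const 1ℚ mod-y
inv-≐1-mod-y {F} F≐1 i =
  sym (sumTo-extend (i ℕ.+ 0) _ z≤n (λ m 0<m → yOrder≥-^ˢ 1-F-yOrder≥1 m i 0 0<m))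
  where
  1-F-yOrder≥1 : YOrder≥ 1 (const 1ℚ ⊖ F)
  1-F-yOrder≥1 x zero    _ = trans (cong (λ z → const 1ℚ x 0 - z) (F≐1 x)) (+-inverseʳ (const 1ℚ x 0))
  1-F-yOrder≥1 x (suc y) (s≤s ())

B≐Xs-mod-y : B ≐ Xs mod-y
B≐Xs-mod-y i =
  trans (cong (λ z → const 1ℚ i 0 - z)
          (trans (⊛-cong-mod-y {const 1ℚ ⊖ Xs} {const 1ℚ ⊖ Xs} {inv Q} {const 1ℚ}
                               (λ _ → refl) (inv-≐1-mod-y Q≐1-mod-y) i)
                 (⊛-identityʳ (const 1ℚ ⊖ Xs) i 0)))
        (solve 2 (λ c x → c :- (c :- x) := x) refl (const 1ℚ i 0) (Xs i 0))

V≐Ys-at-y¹ : ∀ i → V i 1 ≡ Ys i 1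
V≐Ys-at-y¹ i =
  trans (⊛-lowest-y {1} {0} {Ys} {Q ⊛ Q} Ys-yOrder≥1 (λ _ _ ()) i)
  (trans (sumTo-cong i (λ a → cong (Ys a 1 *_)
            (trans (⊛-cong-mod-y {Q} {const 1ℚ} {Q} {const 1ℚ} Q≐1-mod-y Q≐1-mod-y (i ∸ a))
                   (⊛-identityˡ (const 1ℚ) (i ∸ a) 0))))
  (trans (sym (⊛-lowest-y {1} {0} {Ys} {const 1ℚ} Ys-yOrder≥1 (λ _ _ ()) i))
         (⊛-identityʳ Ys i 1)))

Admissible-B-V : Admissible B V
Admissible-B-V = order≥1 (B≐Xs-mod-y 0) , yOrder≥-⊛ {1} {0} {Ys} {Q ⊛ Q} Ys-yOrder≥1 (λ _ _ ())

-- A(0,0) = 0 because C has no constant term: the empty arch system is not connected.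
Admissible-A-U : Admissible A U
Admissible-A-U = order≥1 refl , yOrder≥-⊛ {1} {0} {Ys} {inv (one+2C ⊛ one+2C)} Ys-yOrder≥1 (λ _ _ ())

module _ (Q-equation : Q ≐ (const 1ℚ ⊕ (const (fromℕ 2) ⊛ subst C B V))) where
  open ≐-Reasoning

  subst-one+2C-B-V : subst one+2C B V ≐ Q
  subst-one+2C-B-V = begin
      subst one+2C B V
    ≈⟨ subst-⊕ (const 1ℚ) (const (fromℕ 2) ⊛ C) B V ⟩
      subst (const 1ℚ) B V ⊕ subst (const (fromℕ 2) ⊛ C) B V
    ≈⟨ ⊕-cong (subst-const Admissible-B-V 1ℚ) (subst-⊛ Admissible-B-V (const (fromℕ 2)) C) ⟩
      const 1ℚ ⊕ (subst (const (fromℕ 2)) B V ⊛ subst C B V)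
    ≈⟨ ⊕-cong (≐-refl {const 1ℚ}) (⊛-cong (subst-const Admissible-B-V (fromℕ 2)) (≐-refl {subst C B V})) ⟩
      const 1ℚ ⊕ (const (fromℕ 2) ⊛ subst C B V)
    ≈⟨ Q-equation ⟨
      Q
    ∎

  subst-A-B-V : subst A B V ≐ Xs
  subst-A-B-V = begin
      subst A B V
    ≈⟨ subst-⊕ (const 1ℚ) (one+2C ⊛ (Xs ⊖ const 1ℚ)) B V ⟩
      subst (const 1ℚ) B V ⊕ subst (one+2C ⊛ (Xs ⊖ const 1ℚ)) B V
    ≈⟨ ⊕-cong (subst-const Admissible-B-V 1ℚ) (subst-⊛ Admissible-B-V one+2C (Xs ⊖ const 1ℚ)) ⟩
      const 1ℚ ⊕ (subst one+2C B V ⊛ subst (Xs ⊖ const 1ℚ) B V)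
    ≈⟨ ⊕-cong (≐-refl {const 1ℚ}) (⊛-cong subst-one+2C-B-V
         (≐-trans (subst-⊖ Xs (const 1ℚ) B V) (⊖-cong (subst-Xs Admissible-B-V) (subst-const Admissible-B-V 1ℚ)))) ⟩
      const 1ℚ ⊕ (Q ⊛ (B ⊖ const 1ℚ))
    ≈⟨ ⊕-cong (≐-refl {const 1ℚ}) (⊛-distribˡ-⊖ Q B (const 1ℚ)) ⟩
      const 1ℚ ⊕ ((Q ⊛ B) ⊖ (Q ⊛ const 1ℚ))
    ≈⟨ ⊕-cong (≐-refl {const 1ℚ}) (⊖-cong (⊛-distribˡ-⊖ Q (const 1ℚ) [1-x]/Q) (⊛-identityʳ Q)) ⟩
      const 1ℚ ⊕ (((Q ⊛ const 1ℚ) ⊖ (Q ⊛ [1-x]/Q)) ⊖ Q)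
    ≈⟨ ⊕-cong (≐-refl {const 1ℚ})
              (⊖-cong (⊖-cong (⊛-identityʳ Q) (⊛-cancel Q (const 1ℚ ⊖ Xs) refl)) (≐-refl {Q})) ⟩
      const 1ℚ ⊕ ((Q ⊖ (const 1ℚ ⊖ Xs)) ⊖ Q)
    ≈⟨ (λ i j → solve 3 (λ c q x → c :+ ((q :- (c :- x)) :- q) := x) refl (const 1ℚ i j) (Q i j) (Xs i j)) ⟩
      Xs
    ∎
    where
    [1-x]/Q : Ser
    [1-x]/Q = (const 1ℚ ⊖ Xs) ⊛ inv Q

  subst-U-B-V : subst U B V ≐ Ys
  subst-U-B-V = begin
      subst U B V
    ≈⟨ subst-⊛ Admissible-B-V Ys (inv P²) ⟩
      subst Ys B V ⊛ subst (inv P²) B V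
    ≈⟨ ⊛-cong (subst-Ys Admissible-B-V) (≐-refl {subst (inv P²) B V}) ⟩
      (Ys ⊛ (Q ⊛ Q)) ⊛ subst (inv P²) B V
    ≈⟨ ⊛-assoc Ys (Q ⊛ Q) (subst (inv P²) B V) ⟩
      Ys ⊛ ((Q ⊛ Q) ⊛ subst (inv P²) B V)
    ≈⟨ ⊛-cong (≐-refl {Ys}) (⊛-cong Q²≐P²[B,V] (≐-refl {subst (inv P²) B V})) ⟩
      Ys ⊛ (subst P² B V ⊛ subst (inv P²) B V)
    ≈⟨ ⊛-cong (≐-refl {Ys}) (subst-⊛ Admissible-B-V P² (inv P²)) ⟨
      Ys ⊛ subst (P² ⊛ inv P²) B V
    ≈⟨ ⊛-cong (≐-refl {Ys}) (≐-trans (subst-congˡ B V (⊛-inverseʳ P² refl)) (subst-const Admissible-B-V 1ℚ)) ⟩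
      Ys ⊛ const 1ℚ
    ≈⟨ ⊛-identityʳ Ys ⟩
      Ys
    ∎
    where
    P² : Ser
    P² = one+2C ⊛ one+2C
    Q²≐P²[B,V] : (Q ⊛ Q) ≐ subst P² B V
    Q²≐P²[B,V] = ≐-sym (≐-trans (subst-⊛ Admissible-B-V one+2C one+2C) (⊛-cong subst-one+2C-B-V subst-one+2C-B-V))

  subst-B-V-subst-A-U : ∀ F → subst (subst F A U) B V ≐ F
  subst-B-V-subst-A-U F = begin
      subst (subst F A U) B V                  ≈⟨ subst-subst Admissible-A-U Admissible-B-V F ⟩
      subst F (subst A B V) (subst U B V)      ≈⟨ subst-congʳ F subst-A-B-V subst-U-B-V ⟩
      subst F Xs Ys                            ≈⟨ subst-id F ⟩
      F                                        ∎

proposition3p2 : Q ≐ (const 1ℚ ⊕ (const (fromℕ 2) ⊛ subst C B V)) →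
    (subst A B V ≐ Xs) × (subst U B V ≐ Ys)
      × (subst B A U ≐ Xs) × (subst V A U ≐ Ys)
      × (subst Q A U ≐ one+2C)
proposition3p2 Q-equation =
  subst-A-B-V Q-equation , subst-U-B-V Q-equation ,
  undo (subst-Xs Admissible-B-V) , undo (subst-Ys Admissible-B-V) , undo (subst-one+2C-B-V Q-equation)
  where
  undo : ∀ {F G} → subst G B V ≐ F → subst F A U ≐ G
  undo {F} {G} G[B,V]≐F = subst-injective Admissible-B-V B≐Xs-mod-y V≐Ys-at-y¹ (subst F A U) G
    (≐-trans (subst-B-V-subst-A-U Q-equation F) (≐-sym G[B,V]≐F))
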